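{- Let $\mathsf S_n$ ($n\ge1$) denote the Statman tautologies defined in the context. There exist proofs $\Pi_n$ of $\mathsf S_n$ in the CoS proof system $\mathsf{KS}$ whose size is quadratic in the size of the tautology they prove, i.e. $|\Pi_n|\in O(|\mathsf S_n|^2)$.
   Context: Calculus of structures (CoS). Formulae are built from the units $\mathsf f$ (false) and $\mathsf t$ (true), atoms $a,b,c,\dots$ and $\bar a,\bar b,\dots$, and formula variables $A,B,\dots$ and $\bar A,\bar B,\dots$, by binary disjunction $[\alpha\vee\beta]$ and binary conjunction $(\alpha\wedge\beta)$. The map $\bar\cdot$ is an involution on atoms with $\bar a\neq a$, and likewise on formula variables. The De Morgan dual $\bar\alpha$ of a formula is obtained by exchanging $\vee$ with $\wedge$, $\mathsf t$ with $\mathsf f$, and negating every atom and variable. The size $|\alpha|$ of a formula is the number of occurrences of units, atoms and variables in it. A context $\xi\{\ \}$ is a formula with one hole in place of a subformula; $\xi\{\alpha\}$ denotes filling the hole with $\alpha$. A renaming $\rho$ maps atoms to atoms (applied simultaneously, $\bar a\mapsto\overline{\rho(a)}$); a substitution $\sigma$ maps formula variables to formulae (applied simultaneously, $\bar A\mapsto$ dual of $\sigma(A)$). The equality $=$ is the smallest equivalence relation on formulae closed under contexts containing commutativity and associativity of $\vee$ and of $\wedge$, and $[\alpha\vee\mathsf f]=\alpha$, $(\alpha\wedge\mathsf t)=\alpha$, $[\mathsf t\vee\mathsf t]=\mathsf t$, $(\mathsf f\wedge\mathsf f)=\mathsf f$. An inference rule is a pair premiss/conclusion $\alpha/\beta$;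 an instance is $\alpha\rho\sigma/\beta\rho\sigma$; an inference step generated by the rule is $\xi\{\gamma\}/\xi\{\delta\}$ for an instance $\gamma/\delta$ and any context $\xi$. A derivation in a system (finite set of rules) $\mathcal S$ with premiss $\alpha_0$ and conclusion $\alpha_k$ is a chain $\alpha_0,\dots,\alpha_k$ whose successive steps alternate between $=$-steps ($\alpha_i=\alpha_{i+1}$) and steps generated by rules of $\mathcal S$; its size is the total number of occurrences of units, atoms and variables in it. A proof is a derivation with premiss $\mathsf t$. System $\mathsf{KS}$ consists of the rules: atomic interaction $\mathsf t/[a\vee\bar a]$, atomic weakening $\mathsf f/a$, atomic contraction $[a\vee a]/a$ (here $a$ is an atom, instantiated only by renaming), switch $(A\wedge[B\vee C])/[(A\wedge B)\vee C]$ and medial $[(A\wedge B)\vee(C\wedge D)]/([A\vee C]\wedge[B\vee D])$. Statman tautologies. For atoms $c_i,d_i$ ($i\ge1$), let $\alpha_i\equiv[\bar c_i\vee\bar d_i]$; for $n\ge k\ge1$ let $\beta^n_k\equiv\alpha_n\wedge\alpha_{n-1}\wedge\dots\wedge\alpha_k$ (so $\beta^k_k=\alpha_k$ and $\beta^n_k=(\alpha_n\wedge\beta^{n-1}_k)$ for $n>k$); for $n>k\ge1$ let $\gamma^n_k\equiv(\beta^n_{k+1}\wedge c_k)$ and $\delta^n_k\equiv(\beta^n_{k+1}\wedge d_k)$. Then for $n\ge1$, $\mathsf S_n\equiv[\bar\alpha_n\vee[(\gamma^n_{n-1}\wedge\delta^n_{n-1})\vee[\dots\vee[(\gamma^n_1\wedge\delta^n_1)\vee\alpha_1]\dots]]]$,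 where $\bar\alpha_n=(c_n\wedge d_n)$; e.g. $\mathsf S_1=[(c_1\wedge d_1)\vee[\bar c_1\vee\bar d_1]]$. One has $|\mathsf S_n|=2n^2+2$. -}

module Defs where

open import Data.Nat using (ℕ; zero; suc; _+_; _*_; _∸_; _≤_)
open import Data.Bool using (Bool; true; false; not)
open import Data.Product using (_×_; _,_; Σ; ∃)
open import Data.List using (List; []; _∷_)
open import Data.List.Membership.Propositional using (_∈_)
open import Relation.Binary.PropositionalEquality using (_≡_)

-- Atoms and formula variables: a name (ℕ) together with a polarity.
-- (x , true) is the positive symbol, (x , false) its negation; the
-- involution ¯ flips the polarity, so ā ≠ a.

Lit : Set
Lit = ℕ × Bool

neg : Lit → Lit
neg (x , p) = (x , not p)

infixr 6 _∨_
infixr 7 _∧_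

data Formula : Set where
  𝕗 𝕥   : Formula
  atom  : Lit → Formula
  var   : Lit → Formula
  _∨_   : Formula → Formula → Formula
  _∧_   : Formula → Formula → Formula

dual : Formula → Formula
dual 𝕗 = 𝕥
dual 𝕥 = 𝕗
dual (atom l) = atom (neg l)
dual (var l) = var (neg l)
dual (A ∨ B) = dual A ∧ dual B
dual (A ∧ B) = dual A ∨ dual B

∣_∣ : Formula → ℕ
∣ 𝕗 ∣ = 1
∣ 𝕥 ∣ = 1
∣ atom _ ∣ = 1
∣ var _ ∣ = 1
∣ A ∨ B ∣ = ∣ A ∣ + ∣ B ∣
∣ A ∧ B ∣ = ∣ A ∣ + ∣ B ∣

data Ctx : Set where
  hole : Ctx
  _∨ₗ_ : Ctx → Formula → Ctx
  _∨ᵣ_ : Formula → Ctx → Ctx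
  _∧ₗ_ : Ctx → Formula → Ctx
  _∧ᵣ_ : Formula → Ctx → Ctx

_⟦_⟧ : Ctx → Formula → Formula
hole ⟦ A ⟧ = A
(ξ ∨ₗ B) ⟦ A ⟧ = ξ ⟦ A ⟧ ∨ B
(B ∨ᵣ ξ) ⟦ A ⟧ = B ∨ ξ ⟦ A ⟧
(ξ ∧ₗ B) ⟦ A ⟧ = ξ ⟦ A ⟧ ∧ B
(B ∧ᵣ ξ) ⟦ A ⟧ = B ∧ ξ ⟦ A ⟧

-- A renaming maps atoms to atoms, commuting with the involution:
-- it is determined by its action on positive atoms.
Renaming : Set
Renaming = ℕ → Lit

-- A substitution maps formula variables to formulae, commuting with
-- duality: determined by its action on positive variables.
Subst : Set
Subst = ℕ → Formula

renLit : Renaming → Lit → Lit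
renLit ρ (x , true) = ρ x
renLit ρ (x , false) = neg (ρ x)

rename : Renaming → Formula → Formula
rename ρ 𝕗 = 𝕗
rename ρ 𝕥 = 𝕥
rename ρ (atom l) = atom (renLit ρ l)
rename ρ (var l) = var l
rename ρ (A ∨ B) = rename ρ A ∨ rename ρ B
rename ρ (A ∧ B) = rename ρ A ∧ rename ρ B

subst : Subst → Formula → Formula
subst σ 𝕗 = 𝕗
subst σ 𝕥 = 𝕥
subst σ (atom l) = atom l
subst σ (var (x , true)) = σ x
subst σ (var (x , false)) = dual (σ x)
subst σ (A ∨ B) = subst σ A ∨ subst σ B
subst σ (A ∧ B) = subst σ A ∧ subst σ B

infix 4 _≈_

data _≈_ : Formula → Formula → Set where
  ≈-refl  : ∀ {A} → A ≈ A
  ≈-sym   : ∀ {A B} → A ≈ B → B ≈ A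
  ≈-trans : ∀ {A B C} → A ≈ B → B ≈ C → A ≈ C
  ≈-ctx   : ∀ {A B} (ξ : Ctx) → A ≈ B → ξ ⟦ A ⟧ ≈ ξ ⟦ B ⟧
  ∨-comm  : ∀ {A B} → A ∨ B ≈ B ∨ A
  ∨-assoc : ∀ {A B C} → (A ∨ B) ∨ C ≈ A ∨ (B ∨ C)
  ∧-comm  : ∀ {A B} → A ∧ B ≈ B ∧ A
  ∧-assoc : ∀ {A B C} → (A ∧ B) ∧ C ≈ A ∧ (B ∧ C)
  ∨-unit  : ∀ {A} → A ∨ 𝕗 ≈ A
  ∧-unit  : ∀ {A} → A ∧ 𝕥 ≈ A
  𝕥∨𝕥     : 𝕥 ∨ 𝕥 ≈ 𝕥
  𝕗∧𝕗     : 𝕗 ∧ 𝕗 ≈ 𝕗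

record Rule : Set where
  constructor _/_
  field
    premiss    : Formula
    conclusion : Formula

open Rule public

System : Set
System = List Rule

record Step (S : System) (α β : Formula) : Set where
  field
    rule   : Rule
    inS    : rule ∈ S
    ρ      : Renaming
    σ      : Subst
    ξ      : Ctx
    premEq : α ≡ ξ ⟦ subst σ (rename ρ (premiss rule)) ⟧
    conEq  : β ≡ ξ ⟦ subst σ (rename ρ (conclusion rule)) ⟧

-- Derivations: chains α₀,…,α_k whose successive steps alternate between
-- =-steps and rule steps.  EqFirst: the next step (if any) is an =-step;
-- RuleFirst: the next step (if any) is a rule step.
mutual
  data EqFirst (S : System) : Formula → Formula → Set where
    end  : ∀ {α} → EqFirst S α α
    eq   : ∀ {α β γ} → α ≈ β → RuleFirst S β γ → EqFirst S α γ

  data RuleFirst (S : System) : Formula → Formula → Set where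
    end  : ∀ {α} → RuleFirst S α α
    step : ∀ {α β γ} → Step S α β → EqFirst S β γ → RuleFirst S α γ

data Derivation (S : System) (premiss conclusion : Formula) : Set where
  eqFirst   : EqFirst S premiss conclusion → Derivation S premiss conclusion
  ruleFirst : RuleFirst S premiss conclusion → Derivation S premiss conclusion

mutual
  sizeE : ∀ {S α β} → EqFirst S α β → ℕ
  sizeE {α = α} end = ∣ α ∣
  sizeE {α = α} (eq _ d) = ∣ α ∣ + sizeR d

  sizeR : ∀ {S α β} → RuleFirst S α β → ℕ
  sizeR {α = α} end = ∣ α ∣
  sizeR {α = α} (step _ d) = ∣ α ∣ + sizeE d

sizeD : ∀ {S α β} → Derivation S α β → ℕ
sizeD (eqFirst d) = sizeE d
sizeD (ruleFirst d) = sizeR d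

Proof : System → Formula → Set
Proof S α = Derivation S 𝕥 α

private
  a : Formula
  a = atom (0 , true)
  ā : Formula
  ā = atom (0 , false)
  vA vB vC vD : Formula
  vA = var (0 , true)
  vB = var (1 , true)
  vC = var (2 , true)
  vD = var (3 , true)

ai↓ aw↓ ac↓ s m : Rule
ai↓ = 𝕥 / (a ∨ ā)
aw↓ = 𝕗 / a
ac↓ = (a ∨ a) / a
s   = (vA ∧ (vB ∨ vC)) / ((vA ∧ vB) ∨ vC)
m   = ((vA ∧ vB) ∨ (vC ∧ vD)) / ((vA ∨ vC) ∧ (vB ∨ vD))

KS : System
KS = ai↓ ∷ aw↓ ∷ ac↓ ∷ s ∷ m ∷ []

c d c̄ d̄ : ℕ → Formula
c i = atom (2 * i , true)
d i = atom (suc (2 * i) , true)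
c̄ i = atom (2 * i , false)
d̄ i = atom (suc (2 * i) , false)

αS ᾱS : ℕ → Formula
αS i = c̄ i ∨ d̄ i
ᾱS i = c i ∧ d i

βc : ℕ → ℕ → Formula
βc top zero = αS top
βc top (suc m) = αS top ∧ βc (top ∸ 1) m

β : ℕ → ℕ → Formula
β n k = βc n (n ∸ k)

γ δ : ℕ → ℕ → Formula
γ n k = β n (suc k) ∧ c k
δ n k = β n (suc k) ∧ d k

tailS : ℕ → ℕ → Formula
tailS n zero = αS 1
tailS n (suc k) = (γ n (suc k) ∧ δ n (suc k)) ∨ tailS n k

Statman : ℕ → Formula
Statman n = ᾱS n ∨ tailS n (n ∸ 1)

module Submission where

open import Defs
open import Data.Nat using (ℕ; _*_; _≤_)
open import Data.Product using (Σ; ∃)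
open import Data.Nat using (zero; suc; _+_; _∸_; _<_; _⊔_; z≤n; s≤s)
open import Data.Nat.Properties
open import Data.Nat.Tactic.RingSolver using (solve-∀)
open import Algebra.Properties.CommutativeSemigroup +-commutativeSemigroup using (xy∙z≈xz∙y)
open import Data.Bool using (true; false)
open import Data.Unit using (tt)
open import Data.Bool.Properties using (not-involutive)
open import Data.Product using (_,_; proj₁; proj₂)
open import Data.List.Relation.Unary.Any using (here; there)
open import Relation.Binary.PropositionalEquality using (_≡_; refl; cong; cong₂; sym; trans; module ≡-Reasoning)

-- S₁ = ᾱ₁ ∨ α₁ is proved by atomic interaction,
-- and S_{n+1} is derived from S_n with O(n) rule steps: the disjunct
-- ᾱ_n = c_n ∧ d_n becomes ((α_{n+1} ∧ c_n) ∧ (α_{n+1} ∧ d_n)) ∨ ᾱ_{n+1} by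
-- introducing α_{n+1} ∨ ᾱ_{n+1} twice, switching and contracting ("core");
-- then ᾱ_{n+1} is carried rightwards across the remaining disjuncts γ ∧ δ,
-- turning each into (α_{n+1} ∧ γ) ∧ (α_{n+1} ∧ δ) and contracting the new
-- copy of ᾱ_{n+1} at once ("absorb").  Both are substitution instances of
-- fixed derivations with formula variables.  Hence the proof of S_N has O(N²)
-- steps, every formula in it has size |S_N| + O(N) = O(N²), and its size is
-- O(N⁴) = O(|S_N|²) because |S_N| = 2N² + 2; the constant obtained is 450.

≡⇒≈ : ∀ {A B} → A ≡ B → A ≈ B
≡⇒≈ refl = ≈-refl

dual-involutive : ∀ F → dual (dual F) ≡ F
dual-involutive 𝕗 = refl
dual-involutive 𝕥 = refl
dual-involutive (atom (x , p)) = cong (λ q → atom (x , q)) (not-involutive p)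
dual-involutive (var (x , p)) = cong (λ q → var (x , q)) (not-involutive p)
dual-involutive (A ∨ B) = cong₂ _∨_ (dual-involutive A) (dual-involutive B)
dual-involutive (A ∧ B) = cong₂ _∧_ (dual-involutive A) (dual-involutive B)

size-dual : ∀ F → ∣ dual F ∣ ≡ ∣ F ∣
size-dual 𝕗 = refl
size-dual 𝕥 = refl
size-dual (atom _) = refl
size-dual (var _) = refl
size-dual (A ∨ B) = cong₂ _+_ (size-dual A) (size-dual B)
size-dual (A ∧ B) = cong₂ _+_ (size-dual A) (size-dual B)

size-positive : ∀ F → 1 ≤ ∣ F ∣
size-positive 𝕗 = s≤s z≤n
size-positive 𝕥 = s≤s z≤n
size-positive (atom _) = s≤s z≤n
size-positive (var _) = s≤s z≤n
size-positive (A ∨ B) = ≤-trans (size-positive A) (m≤m+n _ _)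
size-positive (A ∧ B) = ≤-trans (size-positive A) (m≤m+n _ _)

-- Substitutions commute with duality, hence compose.
subst-dual : ∀ σ F → subst σ (dual F) ≡ dual (subst σ F)
subst-dual σ 𝕗 = refl
subst-dual σ 𝕥 = refl
subst-dual σ (atom _) = refl
subst-dual σ (var (x , true)) = refl
subst-dual σ (var (x , false)) = sym (dual-involutive (σ x))
subst-dual σ (A ∨ B) = cong₂ _∧_ (subst-dual σ A) (subst-dual σ B)
subst-dual σ (A ∧ B) = cong₂ _∨_ (subst-dual σ A) (subst-dual σ B)

_∘ₛ_ : Subst → Subst → Subst
(σ ∘ₛ τ) x = subst σ (τ x)

subst-∘ : ∀ σ τ F → subst σ (subst τ F) ≡ subst (σ ∘ₛ τ) F
subst-∘ σ τ 𝕗 = refl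
subst-∘ σ τ 𝕥 = refl
subst-∘ σ τ (atom _) = refl
subst-∘ σ τ (var (x , true)) = refl
subst-∘ σ τ (var (x , false)) = subst-dual σ (τ x)
subst-∘ σ τ (A ∨ B) = cong₂ _∨_ (subst-∘ σ τ A) (subst-∘ σ τ B)
subst-∘ σ τ (A ∧ B) = cong₂ _∧_ (subst-∘ σ τ A) (subst-∘ σ τ B)

size-subst : ∀ σ {K} → 1 ≤ K → (∀ x → ∣ σ x ∣ ≤ K) → ∀ F → ∣ subst σ F ∣ ≤ ∣ F ∣ * K
size-subst σ {K} 1≤K bound = go
  where
    unit : 1 ≤ 1 * K
    unit = ≤-trans 1≤K (≤-reflexive (sym (*-identityˡ K)))

    go : ∀ F → ∣ subst σ F ∣ ≤ ∣ F ∣ * K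
    go 𝕗 = unit
    go 𝕥 = unit
    go (atom _) = unit
    go (var (x , true)) = ≤-trans (bound x) (≤-reflexive (sym (*-identityˡ K)))
    go (var (x , false)) =
      ≤-trans (≤-reflexive (size-dual (σ x))) (≤-trans (bound x) (≤-reflexive (sym (*-identityˡ K))))
    go (A ∨ B) = ≤-trans (+-mono-≤ (go A) (go B)) (≤-reflexive (sym (*-distribʳ-+ K (∣ A ∣) (∣ B ∣))))
    go (A ∧ B) = ≤-trans (+-mono-≤ (go A) (go B)) (≤-reflexive (sym (*-distribʳ-+ K (∣ A ∣) (∣ B ∣))))

substCtx : Subst → Ctx → Ctx
substCtx σ hole = hole
substCtx σ (ξ ∨ₗ B) = substCtx σ ξ ∨ₗ subst σ B
substCtx σ (B ∨ᵣ ξ) = subst σ B ∨ᵣ substCtx σ ξ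
substCtx σ (ξ ∧ₗ B) = substCtx σ ξ ∧ₗ subst σ B
substCtx σ (B ∧ᵣ ξ) = subst σ B ∧ᵣ substCtx σ ξ

subst-plug : ∀ σ ξ A → subst σ (ξ ⟦ A ⟧) ≡ substCtx σ ξ ⟦ subst σ A ⟧
subst-plug σ hole A = refl
subst-plug σ (ξ ∨ₗ B) A = cong (_∨ subst σ B) (subst-plug σ ξ A)
subst-plug σ (B ∨ᵣ ξ) A = cong (subst σ B ∨_) (subst-plug σ ξ A)
subst-plug σ (ξ ∧ₗ B) A = cong (_∧ subst σ B) (subst-plug σ ξ A)
subst-plug σ (B ∧ᵣ ξ) A = cong (subst σ B ∧_) (subst-plug σ ξ A)

_∘ᶜ_ : Ctx → Ctx → Ctx
hole ∘ᶜ ζ = ζ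
(ξ ∨ₗ B) ∘ᶜ ζ = (ξ ∘ᶜ ζ) ∨ₗ B
(B ∨ᵣ ξ) ∘ᶜ ζ = B ∨ᵣ (ξ ∘ᶜ ζ)
(ξ ∧ₗ B) ∘ᶜ ζ = (ξ ∘ᶜ ζ) ∧ₗ B
(B ∧ᵣ ξ) ∘ᶜ ζ = B ∧ᵣ (ξ ∘ᶜ ζ)

plug-∘ᶜ : ∀ ξ ζ A → ξ ⟦ ζ ⟦ A ⟧ ⟧ ≡ (ξ ∘ᶜ ζ) ⟦ A ⟧
plug-∘ᶜ hole ζ A = refl
plug-∘ᶜ (ξ ∨ₗ B) ζ A = cong (_∨ B) (plug-∘ᶜ ξ ζ A)
plug-∘ᶜ (B ∨ᵣ ξ) ζ A = cong (B ∨_) (plug-∘ᶜ ξ ζ A)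
plug-∘ᶜ (ξ ∧ₗ B) ζ A = cong (_∧ B) (plug-∘ᶜ ξ ζ A)
plug-∘ᶜ (B ∧ᵣ ξ) ζ A = cong (B ∧_) (plug-∘ᶜ ξ ζ A)

ctxSize : Ctx → ℕ
ctxSize hole = 0
ctxSize (ξ ∨ₗ B) = ctxSize ξ + ∣ B ∣
ctxSize (B ∨ᵣ ξ) = ∣ B ∣ + ctxSize ξ
ctxSize (ξ ∧ₗ B) = ctxSize ξ + ∣ B ∣
ctxSize (B ∧ᵣ ξ) = ∣ B ∣ + ctxSize ξ

size-plug : ∀ ξ A → ∣ ξ ⟦ A ⟧ ∣ ≡ ctxSize ξ + ∣ A ∣
size-plug hole A = refl
size-plug (ξ ∨ₗ B) A = trans (cong (_+ ∣ B ∣) (size-plug ξ A)) (xy∙z≈xz∙y (ctxSize ξ) (∣ A ∣) (∣ B ∣))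
size-plug (B ∨ᵣ ξ) A = trans (cong (∣ B ∣ +_) (size-plug ξ A)) (sym (+-assoc (∣ B ∣) (ctxSize ξ) (∣ A ∣)))
size-plug (ξ ∧ₗ B) A = trans (cong (_+ ∣ B ∣) (size-plug ξ A)) (xy∙z≈xz∙y (ctxSize ξ) (∣ A ∣) (∣ B ∣))
size-plug (B ∧ᵣ ξ) A = trans (cong (∣ B ∣ +_) (size-plug ξ A)) (sym (+-assoc (∣ B ∣) (ctxSize ξ) (∣ A ∣)))

≈-subst : ∀ σ {A B} → A ≈ B → subst σ A ≈ subst σ B
≈-subst σ ≈-refl = ≈-refl
≈-subst σ (≈-sym p) = ≈-sym (≈-subst σ p)
≈-subst σ (≈-trans p q) = ≈-trans (≈-subst σ p) (≈-subst σ q)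
≈-subst σ (≈-ctx {A} {B} ξ p) =
  ≈-trans (≡⇒≈ (subst-plug σ ξ A))
    (≈-trans (≈-ctx (substCtx σ ξ) (≈-subst σ p)) (≡⇒≈ (sym (subst-plug σ ξ B))))
≈-subst σ ∨-comm = ∨-comm
≈-subst σ ∨-assoc = ∨-assoc
≈-subst σ ∧-comm = ∧-comm
≈-subst σ ∧-assoc = ∧-assoc
≈-subst σ ∨-unit = ∨-unit
≈-subst σ ∧-unit = ∧-unit
≈-subst σ 𝕥∨𝕥 = 𝕥∨𝕥
≈-subst σ 𝕗∧𝕗 = 𝕗∧𝕗

step-subst : ∀ σ {S A B} → Step S A B → Step S (subst σ A) (subst σ B)
step-subst σ st = record
  { rule = rule ; inS = inS ; ρ = ρ ; σ = σ ∘ₛ τ ; ξ = substCtx σ ξ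
  ; premEq = instance-eq premiss premEq
  ; conEq = instance-eq conclusion conEq }
  where
    open Step st renaming (σ to τ)
    instance-eq : ∀ (side : Rule → Formula) {X} → X ≡ ξ ⟦ subst τ (rename ρ (side rule)) ⟧ →
                  subst σ X ≡ substCtx σ ξ ⟦ subst (σ ∘ₛ τ) (rename ρ (side rule)) ⟧
    instance-eq side refl =
      trans (subst-plug σ ξ _) (cong (substCtx σ ξ ⟦_⟧) (subst-∘ σ τ (rename ρ (side rule))))

step-ctx : ∀ ζ {S A B} → Step S A B → Step S (ζ ⟦ A ⟧) (ζ ⟦ B ⟧)
step-ctx ζ st = record
  { rule = rule ; inS = inS ; ρ = ρ ; σ = σ ; ξ = ζ ∘ᶜ ξ
  ; premEq = trans (cong (ζ ⟦_⟧) premEq) (plug-∘ᶜ ζ ξ _)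
  ; conEq = trans (cong (ζ ⟦_⟧) conEq) (plug-∘ᶜ ζ ξ _) }
  where open Step st

-- Chains: derivations in which =-steps and rule steps may occur in any order,
-- indexed by the number of rule steps.  The width of a chain is the size of
-- its largest formula.

infixr 5 _≈⟫_ _▸_

data Chain (S : System) : ℕ → Formula → Formula → Set where
  done : ∀ {α} → Chain S 0 α α
  _≈⟫_ : ∀ {α β γ s} → α ≈ β → Chain S s β γ → Chain S s α γ
  _▸_  : ∀ {α β γ s} → Step S α β → Chain S s β γ → Chain S (suc s) α γ

module _ {S : System} where

  infixr 5 _++_
  infixl 6 _⟫≈_

  width : ∀ {s α β} → Chain S s α β → ℕ
  width {α = α} done = ∣ α ∣
  width {α = α} (_ ≈⟫ c) = ∣ α ∣ ⊔ width c
  width {α = α} (_ ▸ c) = ∣ α ∣ ⊔ width c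

  source≤width : ∀ {s α β} (c : Chain S s α β) → ∣ α ∣ ≤ width c
  source≤width done = ≤-refl
  source≤width (_ ≈⟫ c) = m≤m⊔n _ _
  source≤width (_ ▸ c) = m≤m⊔n _ _

  target≤width : ∀ {s α β} (c : Chain S s α β) → ∣ β ∣ ≤ width c
  target≤width done = ≤-refl
  target≤width (_ ≈⟫ c) = ≤-trans (target≤width c) (m≤n⊔m _ _)
  target≤width (_ ▸ c) = ≤-trans (target≤width c) (m≤n⊔m _ _)

  _++_ : ∀ {s t α β γ} → Chain S s α β → Chain S t β γ → Chain S (s + t) α γ
  done ++ d = d
  (e ≈⟫ c) ++ d = e ≈⟫ (c ++ d)
  (st ▸ c) ++ d = st ▸ (c ++ d)

  width-++ : ∀ {M s t α β γ} (c : Chain S s α β) (d : Chain S t β γ) →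
             width c ≤ M → width d ≤ M → width (c ++ d) ≤ M
  width-++ done d _ wd = wd
  width-++ (e ≈⟫ c) d wc wd = ⊔-lub (m⊔n≤o⇒m≤o _ _ wc) (width-++ c d (m⊔n≤o⇒n≤o _ _ wc) wd)
  width-++ (st ▸ c) d wc wd = ⊔-lub (m⊔n≤o⇒m≤o _ _ wc) (width-++ c d (m⊔n≤o⇒n≤o _ _ wc) wd)

  _⟫≈_ : ∀ {s α β γ} → Chain S s α β → β ≈ γ → Chain S s α γ
  done ⟫≈ e = e ≈⟫ done
  (e′ ≈⟫ c) ⟫≈ e = e′ ≈⟫ (c ⟫≈ e)
  (st ▸ c) ⟫≈ e = st ▸ (c ⟫≈ e)

  width-⟫≈ : ∀ {M s α β γ} (c : Chain S s α β) (e : β ≈ γ) →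
             width c ≤ M → ∣ γ ∣ ≤ M → width (c ⟫≈ e) ≤ M
  width-⟫≈ done e wc wγ = ⊔-lub wc wγ
  width-⟫≈ (e′ ≈⟫ c) e wc wγ = ⊔-lub (m⊔n≤o⇒m≤o _ _ wc) (width-⟫≈ c e (m⊔n≤o⇒n≤o _ _ wc) wγ)
  width-⟫≈ (st ▸ c) e wc wγ = ⊔-lub (m⊔n≤o⇒m≤o _ _ wc) (width-⟫≈ c e (m⊔n≤o⇒n≤o _ _ wc) wγ)

  lift : ∀ ζ {s α β} → Chain S s α β → Chain S s (ζ ⟦ α ⟧) (ζ ⟦ β ⟧)
  lift ζ done = done
  lift ζ (e ≈⟫ c) = ≈-ctx ζ e ≈⟫ lift ζ c
  lift ζ (st ▸ c) = step-ctx ζ st ▸ lift ζ c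

  width-lift : ∀ ζ {s α β} (c : Chain S s α β) → width (lift ζ c) ≡ ctxSize ζ + width c
  width-lift ζ {α = α} done = size-plug ζ α
  width-lift ζ {α = α} (e ≈⟫ c) =
    trans (cong₂ _⊔_ (size-plug ζ α) (width-lift ζ c)) (sym (+-distribˡ-⊔ (ctxSize ζ) (∣ α ∣) (width c)))
  width-lift ζ {α = α} (st ▸ c) =
    trans (cong₂ _⊔_ (size-plug ζ α) (width-lift ζ c)) (sym (+-distribˡ-⊔ (ctxSize ζ) (∣ α ∣) (width c)))

  instantiate : ∀ σ {s α β} → Chain S s α β → Chain S s (subst σ α) (subst σ β)
  instantiate σ done = done
  instantiate σ (e ≈⟫ c) = ≈-subst σ e ≈⟫ instantiate σ c
  instantiate σ (st ▸ c) = step-subst σ st ▸ instantiate σ c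

  width-instantiate : ∀ σ {K} → 1 ≤ K → (∀ x → ∣ σ x ∣ ≤ K) →
                      ∀ {s α β} (c : Chain S s α β) → width (instantiate σ c) ≤ width c * K
  width-instantiate σ {K} 1≤K bound = go
    where
      go : ∀ {s α β} (c : Chain S s α β) → width (instantiate σ c) ≤ width c * K
      go {α = α} done = size-subst σ 1≤K bound α
      go {α = α} (e ≈⟫ c) = ≤-trans (⊔-mono-≤ (size-subst σ 1≤K bound α) (go c))
                                    (≤-reflexive (sym (*-distribʳ-⊔ K (∣ α ∣) (width c))))
      go {α = α} (st ▸ c) = ≤-trans (⊔-mono-≤ (size-subst σ 1≤K bound α) (go c))
                                    (≤-reflexive (sym (*-distribʳ-⊔ K (∣ α ∣) (width c))))

  -- Each rule step contributes two formulae, hence the size bound.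
  toEqFirst : ∀ {s α β γ} → α ≈ β → Chain S s β γ → EqFirst S α γ
  toEqFirst e done = eq e end
  toEqFirst e (e′ ≈⟫ c) = toEqFirst (≈-trans e e′) c
  toEqFirst e (st ▸ c) = eq e (step st (toEqFirst ≈-refl c))

  size-toEqFirst : ∀ {M s α β γ} (e : α ≈ β) (c : Chain S s β γ) →
                   ∣ α ∣ ≤ M → width c ≤ M → sizeE (toEqFirst e c) ≤ suc s * (M + M)
  size-toEqFirst {M} e done α≤M wc =
    ≤-trans (+-mono-≤ α≤M wc) (≤-reflexive (sym (+-identityʳ (M + M))))
  size-toEqFirst e (e′ ≈⟫ c) α≤M wc = size-toEqFirst (≈-trans e e′) c α≤M (m⊔n≤o⇒n≤o _ _ wc)
  size-toEqFirst {M} {suc s} {α} {β} e (st ▸ c) α≤M wc = begin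
    ∣ α ∣ + (∣ β ∣ + sizeE (toEqFirst ≈-refl c)) ≤⟨ +-mono-≤ α≤M (+-mono-≤ β≤M rest) ⟩
    M + (M + suc s * (M + M))                  ≡⟨ +-assoc M M (suc s * (M + M)) ⟨
    suc (suc s) * (M + M)                      ∎
    where
      open ≤-Reasoning
      β≤M = m⊔n≤o⇒m≤o _ _ wc
      rest = size-toEqFirst ≈-refl c (≤-trans (source≤width c) (m⊔n≤o⇒n≤o _ _ wc)) (m⊔n≤o⇒n≤o _ _ wc)

  chain⇒proof : ∀ {M s α} (c : Chain S s 𝕥 α) → width c ≤ M →
                Σ (Proof S α) λ Π → sizeD Π ≤ suc s * (M + M)
  chain⇒proof c wc = eqFirst (toEqFirst ≈-refl c) , size-toEqFirst ≈-refl c (≤-trans (source≤width c) wc) wc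

instance₄ : Formula → Formula → Formula → Formula → Subst
instance₄ A B C D 0 = A
instance₄ A B C D 1 = B
instance₄ A B C D 2 = C
instance₄ A B C D _ = D

interact : ∀ ξ l → Step KS (ξ ⟦ 𝕥 ⟧) (ξ ⟦ atom l ∨ atom (neg l) ⟧)
interact ξ l = record { rule = ai↓ ; inS = here refl ; ρ = λ _ → l ; σ = λ _ → 𝕗 ; ξ = ξ
                      ; premEq = refl ; conEq = refl }

contract : ∀ ξ l → Step KS (ξ ⟦ atom l ∨ atom l ⟧) (ξ ⟦ atom l ⟧)
contract ξ l = record { rule = ac↓ ; inS = there (there (here refl)) ; ρ = λ _ → l ; σ = λ _ → 𝕗
                      ; ξ = ξ ; premEq = refl ; conEq = refl }

switch : ∀ ξ A B C → Step KS (ξ ⟦ A ∧ (B ∨ C) ⟧) (ξ ⟦ (A ∧ B) ∨ C ⟧)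
switch ξ A B C = record { rule = s ; inS = there (there (there (here refl))) ; ρ = λ _ → (0 , true)
                        ; σ = instance₄ A B C 𝕗 ; ξ = ξ ; premEq = refl ; conEq = refl }

medial : ∀ ξ A B C D → Step KS (ξ ⟦ (A ∧ B) ∨ (C ∧ D) ⟧) (ξ ⟦ (A ∨ C) ∧ (B ∨ D) ⟧)
medial ξ A B C D = record { rule = m ; inS = there (there (there (there (here refl))))
                          ; ρ = λ _ → (0 , true) ; σ = instance₄ A B C D ; ξ = ξ
                          ; premEq = refl ; conEq = refl }

∨-swap : ∀ {A B C} → A ∨ (B ∨ C) ≈ B ∨ (A ∨ C)
∨-swap = ≈-trans (≈-sym ∨-assoc) (≈-trans (≈-ctx (hole ∨ₗ _) ∨-comm) ∨-assoc)

vX vY : Formula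
vX = var (0 , true)
vY = var (1 , true)

⟪_,_⟫ : Formula → Formula → Subst
⟪ P , Q ⟫ zero = P
⟪ P , Q ⟫ (suc _) = Q

⟪,⟫-bound : ∀ P Q x → ∣ ⟪ P , Q ⟫ x ∣ ≤ ∣ P ∣ + ∣ Q ∣
⟪,⟫-bound P Q zero = m≤m+n _ _
⟪,⟫-bound P Q (suc _) = m≤n+m _ _

width-⟪,⟫ : ∀ {S s α β} P Q (c : Chain S s α β) →
            width (instantiate ⟪ P , Q ⟫ c) ≤ width c * (∣ P ∣ + ∣ Q ∣)
width-⟪,⟫ P Q = width-instantiate ⟪ P , Q ⟫ (≤-trans (size-positive P) (m≤m+n _ _)) (⟪,⟫-bound P Q)

module Schemes (p q : Lit) where

  α ᾱ : Formula
  α = atom (neg p) ∨ atom (neg q)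
  ᾱ = atom p ∧ atom q

  interaction : Chain KS 4 𝕥 (α ∨ ᾱ)
  interaction =
    ≈-sym ∧-unit ≈⟫
    interact (hole ∧ₗ 𝕥) p ▸
    interact ((atom p ∨ atom (neg p)) ∧ᵣ hole) q ▸
    switch hole (atom p ∨ atom (neg p)) (atom q) (atom (neg q)) ▸
    ≈-ctx (hole ∨ₗ atom (neg q)) ∧-comm ≈⟫
    switch (hole ∨ₗ atom (neg q)) (atom q) (atom p) (atom (neg p)) ▸
    ≈-trans ∨-assoc (≈-trans ∨-comm (≈-ctx (α ∨ᵣ hole) ∧-comm)) ≈⟫
    done

  contraction : Chain KS 3 (ᾱ ∨ ᾱ) ᾱ
  contraction =
    medial hole (atom p) (atom q) (atom p) (atom q) ▸
    contract (hole ∧ₗ (atom q ∨ atom q)) p ▸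
    contract (atom p ∧ᵣ hole) q ▸
    done

  -- X ∧ Y ⟶ ((α ∧ X) ∧ (α ∧ Y)) ∨ ᾱ: insert α ∨ ᾱ next to X and to Y,
  -- switch both copies of ᾱ out and contract them
  core : Chain KS 15 (vX ∧ vY) (((α ∧ vX) ∧ (α ∧ vY)) ∨ ᾱ)
  core =
    ≈-sym (≈-trans (≈-ctx (hole ∧ₗ (vY ∧ 𝕥)) ∧-unit) (≈-ctx (vX ∧ᵣ hole) ∧-unit)) ≈⟫
    lift ((vX ∧ᵣ hole) ∧ₗ (vY ∧ 𝕥)) interaction ++
    lift ((vX ∧ (α ∨ ᾱ)) ∧ᵣ (vY ∧ᵣ hole)) interaction ++
    switch (hole ∧ₗ (vY ∧ (α ∨ ᾱ))) vX α ᾱ ▸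
    switch (X′ ∧ᵣ hole) vY α ᾱ ▸
    switch hole X′ (vY ∧ α) ᾱ ▸
    ≈-ctx (hole ∨ₗ ᾱ) ∧-comm ≈⟫
    switch (hole ∨ₗ ᾱ) (vY ∧ α) (vX ∧ α) ᾱ ▸
    ∨-assoc ≈⟫
    lift (((vY ∧ α) ∧ (vX ∧ α)) ∨ᵣ hole) contraction ⟫≈
    ≈-ctx (hole ∨ₗ ᾱ) (≈-trans ∧-comm (≈-trans (≈-ctx (hole ∧ₗ (vY ∧ α)) ∧-comm)
                                                (≈-ctx ((α ∧ vX) ∧ᵣ hole) ∧-comm)))
    where
      X′ : Formula
      X′ = (vX ∧ α) ∨ ᾱ

  absorb : Chain KS 18 (ᾱ ∨ (vX ∧ vY)) (((α ∧ vX) ∧ (α ∧ vY)) ∨ ᾱ)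
  absorb = lift (ᾱ ∨ᵣ hole) core ++ ∨-swap ≈⟫ lift (((α ∧ vX) ∧ (α ∧ vY)) ∨ᵣ hole) contraction

  width-core : width core ≡ 10
  width-core = refl

  width-absorb : width absorb ≡ 12
  width-absorb = refl

widen : ℕ → Formula → Formula → Formula
widen n X Y = (αS n ∧ X) ∧ (αS n ∧ Y)

interactionₙ : ∀ n → Chain KS 4 𝕥 (αS n ∨ ᾱS n)
interactionₙ n = Schemes.interaction (2 * n , true) (suc (2 * n) , true)

coreₙ : ∀ n → Chain KS 15 (vX ∧ vY) (widen n vX vY ∨ ᾱS n)
coreₙ n = Schemes.core (2 * n , true) (suc (2 * n) , true)

absorbₙ : ∀ n → Chain KS 18 (ᾱS n ∨ (vX ∧ vY)) (widen n vX vY ∨ ᾱS n)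
absorbₙ n = Schemes.absorb (2 * n , true) (suc (2 * n) , true)

disjunct : ℕ → ℕ → Formula
disjunct n i = γ n i ∧ δ n i

size-βc : ∀ t x → ∣ βc t x ∣ ≡ 2 * suc x
size-βc t zero = refl
size-βc t (suc x) = trans (cong (2 +_) (size-βc (t ∸ 1) x)) (sym (*-suc 2 (suc x)))

size-β : ∀ n m → ∣ β n m ∣ ≡ 2 * suc (n ∸ m)
size-β n m = size-βc n (n ∸ m)

size-β-mono : ∀ n m → ∣ β n m ∣ ≤ ∣ β (suc n) m ∣
size-β-mono n m = ≤-trans (≤-reflexive (size-β n m))
  (≤-trans (*-monoʳ-≤ 2 (s≤s (∸-monoˡ-≤ m (n≤1+n n)))) (≤-reflexive (sym (size-β (suc n) m))))

size-β-bound : ∀ n m → ∣ β n m ∣ ≤ 2 * suc n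
size-β-bound n m = ≤-trans (≤-reflexive (size-β n m)) (*-monoʳ-≤ 2 (s≤s (m∸n≤m n m)))

size-disjunct-bound : ∀ n i → ∣ γ n i ∣ + ∣ δ n i ∣ ≤ 4 * n + 6
size-disjunct-bound n i = ≤-trans (+-mono-≤ half half) (≤-reflexive (arith n))
  where
    half : ∣ β n (suc i) ∣ + 1 ≤ 2 * suc n + 1
    half = +-monoˡ-≤ 1 (size-β-bound n (suc i))
    arith : ∀ n → 2 * suc n + 1 + (2 * suc n + 1) ≡ 4 * n + 6
    arith = solve-∀

size-tail-mono : ∀ n j → ∣ tailS n j ∣ ≤ ∣ tailS (suc n) j ∣
size-tail-mono n zero = ≤-refl
size-tail-mono n (suc j) = +-mono-≤ (+-mono-≤ half half) (size-tail-mono n j)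
  where
    half : ∣ β n (suc (suc j)) ∣ + 1 ≤ ∣ β (suc n) (suc (suc j)) ∣ + 1
    half = +-monoˡ-≤ 1 (size-β-mono n (suc (suc j)))

size-Statman-mono : ∀ n → ∣ Statman (suc n) ∣ ≤ ∣ Statman (suc (suc n)) ∣
size-Statman-mono n = +-monoʳ-≤ 2 (≤-trans (size-tail-mono (suc n) n) (m≤n+m _ _))

size-tail : ∀ r j → ∣ tailS (suc (r + j)) j ∣ ≡ 2 + 2 * j * (j + 2 * r + 2)
size-tail r zero = refl
size-tail r (suc j) = begin
    (∣ β n (suc (suc j)) ∣ + 1) + (∣ β n (suc (suc j)) ∣ + 1) + ∣ tailS n j ∣
      ≡⟨ cong₂ (λ b t → (b + 1) + (b + 1) + t) size-top size-rest ⟩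
    (2 * suc r + 1) + (2 * suc r + 1) + (2 + 2 * j * (j + 2 * suc r + 2))
      ≡⟨ arith r j ⟩
    2 + 2 * suc j * (suc j + 2 * r + 2) ∎
  where
    open ≡-Reasoning
    n = suc (r + suc j)
    size-top : ∣ β n (suc (suc j)) ∣ ≡ 2 * suc r
    size-top = trans (size-β n (suc (suc j))) (cong (λ x → 2 * suc x) (m+n∸n≡m r (suc j)))
    size-rest : ∣ tailS n j ∣ ≡ 2 + 2 * j * (j + 2 * suc r + 2)
    size-rest = trans (cong (λ x → ∣ tailS (suc x) j ∣) (+-suc r j)) (size-tail (suc r) j)
    arith : ∀ r j → (2 * suc r + 1) + (2 * suc r + 1) + (2 + 2 * j * (j + 2 * suc r + 2))
                    ≡ 2 + 2 * suc j * (suc j + 2 * r + 2)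
    arith = solve-∀

size-Statman : ∀ n → ∣ Statman (suc n) ∣ ≡ 2 * (suc n * suc n) + 2
size-Statman n = trans (cong (2 +_) (size-tail 0 n)) (arith n)
  where
    arith : ∀ n → 2 + (2 + 2 * n * (n + 2 * 0 + 2)) ≡ 2 * (suc n * suc n) + 2
    arith = solve-∀

β-top : ∀ n → β (suc n) (suc n) ≡ αS (suc n)
β-top n = cong (βc (suc n)) (n∸n≡0 n)

β-suc : ∀ {n m} → m ≤ n → β (suc n) m ≡ αS (suc n) ∧ β n m
β-suc {n} m≤n = cong (βc (suc n)) (+-∸-assoc 1 m≤n)

top-disjunct : ∀ n → widen (suc n) (c n) (d n) ≈ disjunct (suc n) n
top-disjunct n = ≡⇒≈ (cong (λ B → (B ∧ c n) ∧ (B ∧ d n)) (sym (β-top n)))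

raise-disjunct : ∀ {n i} → suc (suc i) ≤ n →
                 widen (suc n) (γ n (suc i)) (δ n (suc i)) ≈ disjunct (suc n) (suc i)
raise-disjunct {n} {i} le =
  ≈-trans (≈-trans (≈-ctx (hole ∧ₗ _) (≈-sym ∧-assoc)) (≈-ctx (_ ∧ᵣ hole) (≈-sym ∧-assoc)))
          (≡⇒≈ (cong (λ B → (B ∧ c (suc i)) ∧ (B ∧ d (suc i))) (sym (β-suc le))))

-- Both scheme instances leave (W ∨ ᾱ) ∨ R with a finished disjunct W; the
-- chain continuing on ᾱ ∨ R is then run beside W, and ᾱ is moved to the front.
push : ∀ {S s W B Ā R R′} → W ≈ B → Chain S s (Ā ∨ R) (Ā ∨ R′) →
       Chain S s ((W ∨ Ā) ∨ R) (Ā ∨ (B ∨ R′))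
push {B = B} e c = ≈-trans ∨-assoc (≈-ctx (hole ∨ₗ _) e) ≈⟫ lift (B ∨ᵣ hole) c ⟫≈ ∨-swap

width-push : ∀ {S s W B Ā R R′} slack (e : W ≈ B) (c : Chain S s (Ā ∨ R) (Ā ∨ R′)) →
             ∣ (W ∨ Ā) ∨ R ∣ ≤ ∣ Ā ∨ (B ∨ R′) ∣ + slack → width c ≤ ∣ Ā ∨ R′ ∣ + slack →
             width (push e c) ≤ ∣ Ā ∨ (B ∨ R′) ∣ + slack
width-push {B = B} {Ā} {R′ = R′} slack e c first wc =
  ⊔-lub first (width-⟫≈ (lift (B ∨ᵣ hole) c) ∨-swap lifted (m≤m+n _ _))
  where
    open ≤-Reasoning
    arith : ∀ b a r x → b + (a + r + x) ≡ a + (b + r) + x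
    arith = solve-∀
    lifted : width (lift (B ∨ᵣ hole) c) ≤ ∣ Ā ∨ (B ∨ R′) ∣ + slack
    lifted = begin
      width (lift (B ∨ᵣ hole) c)            ≡⟨ width-lift (B ∨ᵣ hole) c ⟩
      ∣ B ∣ + 0 + width c                    ≡⟨ cong (_+ width c) (+-identityʳ (∣ B ∣)) ⟩
      ∣ B ∣ + width c                        ≤⟨ +-monoʳ-≤ (∣ B ∣) wc ⟩
      ∣ B ∣ + (∣ Ā ∣ + ∣ R′ ∣ + slack)       ≡⟨ arith (∣ B ∣) (∣ Ā ∣) (∣ R′ ∣) slack ⟩
      ∣ Ā ∨ (B ∨ R′) ∣ + slack               ∎

-- The extra size, beyond that of the current Statman formula, of the formulae
-- occurring while passing from S_n to S_{n+1}: instances of the scheme absorb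
-- (width 12) at variables of total size ≤ 4n + 6.
slack : ℕ → ℕ
slack n = 12 * (4 * n + 6)

slack-mono : ∀ n → slack n ≤ slack (suc n)
slack-mono n = *-monoʳ-≤ 12 (+-monoˡ-≤ 6 (*-monoʳ-≤ 4 (n≤1+n n)))

absorb-disjunct : ∀ n i →
  Chain KS 18 (ᾱS (suc n) ∨ tailS n (suc i)) ((widen (suc n) (γ n (suc i)) (δ n (suc i)) ∨ ᾱS (suc n)) ∨ tailS n i)
absorb-disjunct n i =
  ≈-sym ∨-assoc ≈⟫ lift (hole ∨ₗ tailS n i) (instantiate ⟪ γ n (suc i) , δ n (suc i) ⟫ (absorbₙ (suc n)))

width-absorb-disjunct : ∀ n i →
  width (absorb-disjunct n i) ≤ ∣ ᾱS (suc n) ∨ tailS (suc n) (suc i) ∣ + slack n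
width-absorb-disjunct n i = ⊔-lub first (begin
    width absorbed                                 ≡⟨ width-lift (hole ∨ₗ tailS n i) instance-absorb ⟩
    ∣ tailS n i ∣ + width instance-absorb          ≤⟨ +-mono-≤ (size-tail-mono n i) instance-small ⟩
    ∣ tailS (suc n) i ∣ + slack n                  ≤⟨ +-monoˡ-≤ (slack n) tail-grows ⟩
    ∣ ᾱS (suc n) ∨ tailS (suc n) (suc i) ∣ + slack n ∎)
  where
    open ≤-Reasoning
    instance-absorb : Chain KS 18 (ᾱS (suc n) ∨ disjunct n (suc i))
                                  (widen (suc n) (γ n (suc i)) (δ n (suc i)) ∨ ᾱS (suc n))
    instance-absorb = instantiate ⟪ γ n (suc i) , δ n (suc i) ⟫ (absorbₙ (suc n))
    absorbed : Chain KS 18 ((ᾱS (suc n) ∨ disjunct n (suc i)) ∨ tailS n i)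
                           ((widen (suc n) (γ n (suc i)) (δ n (suc i)) ∨ ᾱS (suc n)) ∨ tailS n i)
    absorbed = lift (hole ∨ₗ tailS n i) instance-absorb
    first : ∣ ᾱS (suc n) ∨ tailS n (suc i) ∣ ≤ ∣ ᾱS (suc n) ∨ tailS (suc n) (suc i) ∣ + slack n
    first = ≤-trans (+-monoʳ-≤ 2 (size-tail-mono n (suc i))) (m≤m+n _ _)
    instance-small : width instance-absorb ≤ slack n
    instance-small =
      ≤-trans (width-⟪,⟫ (γ n (suc i)) (δ n (suc i)) (absorbₙ (suc n)))
        (≤-trans (≤-reflexive (cong (_* (∣ γ n (suc i) ∣ + ∣ δ n (suc i) ∣))
                                    (Schemes.width-absorb (2 * suc n , true) (suc (2 * suc n) , true))))
                 (*-monoʳ-≤ 12 (size-disjunct-bound n (suc i))))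
    tail-grows : ∣ tailS (suc n) i ∣ ≤ ∣ ᾱS (suc n) ∨ tailS (suc n) (suc i) ∣
    tail-grows = ≤-trans (m≤n+m _ (∣ disjunct (suc n) (suc i) ∣)) (m≤n+m _ 2)

raise-tail : ∀ n j → j < n →
             Chain KS (j * 18) (ᾱS (suc n) ∨ tailS n j) (ᾱS (suc n) ∨ tailS (suc n) j)
raise-tail n zero _ = done
raise-tail n (suc i) lt =
  absorb-disjunct n i ++ push (raise-disjunct lt) (raise-tail n i (≤-trans (n≤1+n _) lt))

width-raise-tail : ∀ n j (lt : j < n) →
                   width (raise-tail n j lt) ≤ ∣ ᾱS (suc n) ∨ tailS (suc n) j ∣ + slack n
width-raise-tail n zero _ = m≤m+n _ _
width-raise-tail n (suc i) lt =
  width-++ (absorb-disjunct n i) (push (raise-disjunct lt) (raise-tail n i i<n))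
    (width-absorb-disjunct n i)
    (width-push (slack n) (raise-disjunct lt) (raise-tail n i i<n)
      (≤-trans (target≤width (absorb-disjunct n i)) (width-absorb-disjunct n i))
      (width-raise-tail n i i<n))
  where
    i<n : i < n
    i<n = ≤-trans (n≤1+n _) lt

open-level : ∀ k →
  Chain KS 15 (Statman (suc k))
              ((widen (suc (suc k)) (c (suc k)) (d (suc k)) ∨ ᾱS (suc (suc k))) ∨ tailS (suc k) k)
open-level k =
  lift (hole ∨ₗ tailS (suc k) k) (instantiate ⟪ c (suc k) , d (suc k) ⟫ (coreₙ (suc (suc k))))

width-open-level : ∀ k → width (open-level k) ≤ ∣ Statman (suc (suc k)) ∣ + slack (suc k)
width-open-level k = begin
    width (open-level k)                       ≡⟨ width-lift (hole ∨ₗ tailS (suc k) k) instance-core ⟩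
    ∣ tailS (suc k) k ∣ + width instance-core   ≤⟨ +-mono-≤ tail-grows instance-small ⟩
    ∣ Statman (suc (suc k)) ∣ + slack (suc k)   ∎
  where
    open ≤-Reasoning
    instance-core : Chain KS 15 (ᾱS (suc k)) (widen (suc (suc k)) (c (suc k)) (d (suc k)) ∨ ᾱS (suc (suc k)))
    instance-core = instantiate ⟪ c (suc k) , d (suc k) ⟫ (coreₙ (suc (suc k)))
    tail-grows : ∣ tailS (suc k) k ∣ ≤ ∣ Statman (suc (suc k)) ∣
    tail-grows = ≤-trans (size-tail-mono (suc k) k) (≤-trans (m≤n+m _ _) (m≤n+m _ 2))
    instance-small : width instance-core ≤ slack (suc k)
    instance-small =
      ≤-trans (width-⟪,⟫ (c (suc k)) (d (suc k)) (coreₙ (suc (suc k))))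
        (≤-trans (≤-reflexive (cong (_* 2) (Schemes.width-core (2 * suc (suc k) , true) (suc (2 * suc (suc k)) , true))))
                 (≤-trans (≤ᵇ⇒≤ 20 72 tt) (*-monoʳ-≤ 12 (m≤n+m 6 (4 * suc k)))))

level : ∀ k → Chain KS (15 + k * 18) (Statman (suc k)) (Statman (suc (suc k)))
level k = open-level k ++ push (top-disjunct (suc k)) (raise-tail (suc k) k ≤-refl)

width-level : ∀ k → width (level k) ≤ ∣ Statman (suc (suc k)) ∣ + slack (suc k)
width-level k =
  width-++ (open-level k) (push (top-disjunct (suc k)) (raise-tail (suc k) k ≤-refl))
    (width-open-level k)
    (width-push (slack (suc k)) (top-disjunct (suc k)) (raise-tail (suc k) k ≤-refl)
      (≤-trans (target≤width (open-level k)) (width-open-level k))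
      (width-raise-tail (suc k) k ≤-refl))

steps : ℕ → ℕ
steps zero = 4
steps (suc n) = steps n + (15 + n * 18)

statman-chain : ∀ n → Chain KS (steps n) 𝕥 (Statman (suc n))
statman-chain zero = interactionₙ 1 ⟫≈ ∨-comm
statman-chain (suc n) = statman-chain n ++ level n

width-statman-chain : ∀ n → width (statman-chain n) ≤ ∣ Statman (suc n) ∣ + slack n
width-statman-chain zero = ≤ᵇ⇒≤ _ _ tt
width-statman-chain (suc n) =
  width-++ (statman-chain n) (level n)
    (≤-trans (width-statman-chain n) (+-mono-≤ (size-Statman-mono n) (slack-mono n)))
    (width-level n)

steps-bound : ∀ n → steps n ≤ 18 * (suc n * suc n)
steps-bound zero = ≤ᵇ⇒≤ 4 18 tt
steps-bound (suc n) = begin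
    steps n + (15 + n * 18)                                 ≤⟨ +-mono-≤ (steps-bound n) (+-monoˡ-≤ (n * 18) (≤ᵇ⇒≤ 15 18 tt)) ⟩
    18 * (suc n * suc n) + (18 + n * 18)                    ≤⟨ m≤m+n _ (18 * n + 36) ⟩
    18 * (suc n * suc n) + (18 + n * 18) + (18 * n + 36)    ≡⟨ arith n ⟩
    18 * (suc (suc n) * suc (suc n))                        ∎
  where
    open ≤-Reasoning
    arith : ∀ n → 18 * (suc n * suc n) + (18 + n * 18) + (18 * n + 36) ≡ 18 * (suc (suc n) * suc (suc n))
    arith = solve-∀

-- In terms of |S_{n+1}| = 2(n+1)² + 2: at most 9·|S_{n+1}| formulae
-- (counted as steps + 1), each of size at most 25·|S_{n+1}|.
steps-vs-size : ∀ n → suc (steps n) ≤ 9 * ∣ Statman (suc n) ∣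
steps-vs-size n = ≤-trans (s≤s (steps-bound n))
  (≤-trans (m≤m+n _ 17) (≤-reflexive (trans (arith n) (cong (9 *_) (sym (size-Statman n))))))
  where
    arith : ∀ n → suc (18 * (suc n * suc n)) + 17 ≡ 9 * (2 * (suc n * suc n) + 2)
    arith = solve-∀

width-vs-size : ∀ n → ∣ Statman (suc n) ∣ + slack n ≤ 25 * ∣ Statman (suc n) ∣
width-vs-size n = +-monoʳ-≤ (∣ Statman (suc n) ∣)
  (≤-trans (m≤m+n _ (48 * n * n + 48 * n + 24))
    (≤-reflexive (trans (arith n) (cong (24 *_) (sym (size-Statman n))))))
  where
    arith : ∀ n → 12 * (4 * n + 6) + (48 * n * n + 48 * n + 24) ≡ 24 * (2 * (suc n * suc n) + 2)
    arith = solve-∀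

-- (number of formulae) × (their maximal size), both linear in S, is quadratic in S
quadratic : ∀ {s M} S k → suc s ≤ 9 * S → M ≤ k * S → suc s * (M + M) ≤ 18 * k * (S * S)
quadratic S k steps≤ M≤ =
  ≤-trans (*-mono-≤ steps≤ (+-mono-≤ M≤ M≤)) (≤-reflexive (arith k S))
  where
    arith : ∀ k S → 9 * S * (k * S + k * S) ≡ 18 * k * (S * S)
    arith = solve-∀

statman-proof : ∀ n → Σ (Proof KS (Statman (suc n))) λ Π →
                sizeD Π ≤ 450 * (∣ Statman (suc n) ∣ * ∣ Statman (suc n) ∣)
statman-proof n =
  proj₁ proof , ≤-trans (proj₂ proof) (quadratic (∣ Statman (suc n) ∣) 25 (steps-vs-size n) (width-vs-size n))
  where
    proof : Σ (Proof KS (Statman (suc n))) λ Π →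
            sizeD Π ≤ suc (steps n) * ((∣ Statman (suc n) ∣ + slack n) + (∣ Statman (suc n) ∣ + slack n))
    proof = chain⇒proof (statman-chain n) (width-statman-chain n)

theorem3p12 : ∃ λ (C : ℕ) → ∀ (n : ℕ) → 1 ≤ n →
    Σ (Proof KS (Statman n)) λ Π → sizeD Π ≤ C * (∣ Statman n ∣ * ∣ Statman n ∣)
theorem3p12 = 450 , λ { (suc n) _ → statman-proof n }
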